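{- Let $w$ be a non-empty finite word with heart $v$. Then $w$ is a GT-word if and only if $v$ is a GT-word. Moreover, when $w$ (equivalently $v$) is a GT-word, the maximal interval $[m_w,M_w]$ on which $C_w$ is constant equals the maximal interval $[m_v,M_v]$ on which $C_v$ is constant, i.e., $m_w=m_v$ and $M_w=M_v$.
   Context: Words are finite sequences of letters; $|w|$ is the length and $\mathrm{Alph}(w)$ the set of letters of $w$. A factor is a contiguous subword. $C_w(n)$ is the number of distinct factors of $w$ of length $n$ ($C_w(n)=0$ for $n>|w|$). A word $w$ with $|\mathrm{Alph}(w)|\ge 2$ is a GT-word if there exist positive integers $m\le M$ such that $C_w(0)=1$, $C_w(i)=|\mathrm{Alph}(w)|+i-1$ for $1\le i\le m$, $C_w(i+1)=C_w(i)$ for $m\le i\le M-1$, and $C_w(i+1)=C_w(i)-1$ for $M\le i\le |w|$; for a GT-word the interval $[m,M]$ with maximal such $M-m$ is the maximal interval on which $C_w$ is constant. Every non-empty word with one distinct letter is also a GT-word. Heart: for a non-empty word $w$, let $r$ be the longest (possibly empty) prefix of $w$ all of whose letters occur exactly once in $w$, and $s$ the longest (possibly empty) suffix of $w$ all of whose letters occur exactly once in $w$. If $|w|>|\mathrm{Alph}(w)|$, the heart of $w$ is the unique non-empty $v$ with $w=rvs$; otherwise the heart of $w$ is $w$. -}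

module Defs where

open import Data.Nat using (ℕ; zero; suc; _+_; _∸_; _≤_; _<_)
open import Data.List using (List; []; _∷_; length; take; drop; reverse; map; filter; takeWhile; deduplicate; upTo; _++_)
open import Data.List.Properties using (≡-dec)
open import Data.Product using (_×_; ∃₂; Σ)
open import Data.Sum using (_⊎_)
open import Relation.Binary.PropositionalEquality using (_≡_; _≢_)
open import Relation.Binary.Definitions using (DecidableEquality)
open import Relation.Nullary.Decidable using (yes; no)
open import Data.Nat.Properties using () renaming (_≟_ to _≟ℕ_)
open import Data.Bool using (if_then_else_)

module _ {A : Set} (_≟_ : DecidableEquality A) where

  Alph : List A → List A
  Alph w = deduplicate _≟_ w

  occ : A → List A → ℕ
  occ a w = length (filter (λ b → a ≟ b) w)

  factorsOfLength : List A → ℕ → List (List A)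
  factorsOfLength w n with n Data.Nat.≤? length w
  ... | yes _ = map (λ i → take n (drop i w)) (upTo (suc (length w ∸ n)))
  ... | no _  = []

  C : List A → ℕ → ℕ
  C w n = length (deduplicate (≡-dec _≟_) (factorsOfLength w n))

  GTParams : List A → ℕ → ℕ → Set
  GTParams w m M =
    1 ≤ m × m ≤ M ×
    C w 0 ≡ 1 ×
    (∀ i → 1 ≤ i → i ≤ m → C w i ≡ length (Alph w) + i ∸ 1) ×
    (∀ i → m ≤ i → i ≤ M ∸ 1 → C w (suc i) ≡ C w i) ×
    (∀ i → M ≤ i → i ≤ length w → C w (suc i) ≡ C w i ∸ 1)

  GTWord : List A → Set
  GTWord w = (2 ≤ length (Alph w) × ∃₂ λ m M → GTParams w m M)
           ⊎ (w ≢ [] × length (Alph w) ≡ 1)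

  -- [m, M] is the maximal interval on which C_w is constant: among all parameter
  -- pairs witnessing the GT conditions, it maximises M - m.
  MaxInterval : List A → ℕ → ℕ → Set
  MaxInterval w m M = GTParams w m M × (∀ m' M' → GTParams w m' M' → M' ∸ m' ≤ M ∸ m)

  heartPrefix : List A → List A
  heartPrefix w = takeWhile (λ a → occ a w ≟ℕ 1) w

  heartSuffix : List A → List A
  heartSuffix w = reverse (takeWhile (λ a → occ a w ≟ℕ 1) (reverse w))

  -- heart: if |w| > |Alph w| then the v with w = r v s, else w itself
  heart : List A → List A
  heart w with length (Alph w) Data.Nat.<? length w
  ... | yes _ = take (length w ∸ length (heartPrefix w) ∸ length (heartSuffix w))
                     (drop (length (heartPrefix w)) w)
  ... | no _  = w

-- Write w = r v s where every letter of r and s occurs exactly once in w.  A letter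
-- x added in front of a word u not containing it contributes exactly one new factor
-- of each length 1 … |u|+1; iterating this, and using that complexity is invariant
-- under reversal to treat s, gives C_w(n) = C_v(n) + k for 1 ≤ n ≤ |v|+1, where
-- k = |r| + |s| = |Alph w| - |Alph v|, while from n = |v| on C_w drops by one per
-- step.  The GT conditions only compare
-- C(i+1) with C(i) and C(i) with |Alph| + i - 1, so they are invariant under the
-- shift by k below |v| (`SameShape`); and the descent of an extension cannot start
-- beyond |v| (`params-bound`).  Hence w and v satisfy the GT conditions for exactly
-- the same parameters m ≤ M (`params⇔`), which gives both claims; one-letter words,
-- a separate case of the definition, satisfy them with m = 1, M = |u|.  Finally the
-- heart is either w itself or w extends it (`heart-cases`).
module Submission where

open import Data.Nat
open import Data.Nat.Properties
open import Data.Nat.Properties using () renaming (_≟_ to _≟ℕ_)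
open import Algebra.Properties.CommutativeSemigroup +-commutativeSemigroup using (xy∙z≈xz∙y)
open import Data.Empty using (⊥-elim)
open import Data.List
  using (List; []; _∷_; length; map; filter; take; drop; upTo; reverse; _++_;
         takeWhile; dropWhile; deduplicate)
open import Data.List.Properties
  using (≡-dec; length-++; length-drop; length-take; take++drop≡id; ++-assoc; ++-identityʳ;
         reverse-++; reverse-involutive; reverse-injective; length-reverse;
         length-++-≤ˡ; length-++-≤ʳ; length-map;
         filter-all; filter-++; filter-accept; filter-some; ∷-injective; takeWhile++dropWhile)
open import Data.List.Membership.Propositional using (_∈_; _∉_)
open import Data.List.Membership.Propositional.Properties
  using (∈-map⁺; ∈-map⁻; ∈-upTo⁺; ∈-upTo⁻; ∈-++⁺ˡ; ∈-++⁺ʳ; ∈-deduplicate⁺; ∈-deduplicate⁻)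
open import Data.List.Membership.Propositional.Properties.WithK using (unique∧set⇒bag)
open import Data.List.Relation.Binary.BagAndSetEquality using (∼bag⇒↭)
open import Data.List.Relation.Binary.Permutation.Propositional.Properties
  using (↭-length; ↭-reverse; filter-↭)
open import Data.List.Relation.Binary.Subset.Propositional using (_⊆_)
open import Data.List.Relation.Unary.All as All using (All; _∷_)
import Data.List.Relation.Unary.All.Properties as All
open import Data.List.Relation.Unary.Any using (here; there)
import Data.List.Relation.Unary.Any.Properties as Any
open import Data.List.Relation.Unary.Unique.Propositional using (Unique)
import Data.List.Relation.Unary.Unique.Propositional.Properties as Unique
open import Data.Product using (_×_; _,_; ∃; ∃₂; proj₁; proj₂)
open import Data.Sum using (_⊎_; inj₁; inj₂)
open import Function.Bundles using (_⇔_; mk⇔; Equivalence)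
open import Function.Definitions using (Injective)
open import Function.Properties.Equivalence using () renaming (refl to ⇔-refl; sym to ⇔-sym)
open import Relation.Binary.Definitions using (DecidableEquality)
open import Relation.Binary.PropositionalEquality
open import Relation.Nullary using (yes; no; ¬_; ¬?)
open import Relation.Unary using (Decidable)

open import Defs

module Distinct {B : Set} (_≟ᴮ_ : DecidableEquality B) where
  open import Data.List.Relation.Unary.Unique.DecPropositional.Properties _≟ᴮ_
    using (deduplicate-!)

  #distinct : List B → ℕ
  #distinct xs = length (deduplicate _≟ᴮ_ xs)

  -- Duplicate-free lists with the same members are permutations of each other.
  unique-length : ∀ {xs ys : List B} → Unique xs → Unique ys →
                  xs ⊆ ys → ys ⊆ xs → length xs ≡ length ys
  unique-length ux uy xs⊆ys ys⊆xs =
    ↭-length (∼bag⇒↭ (unique∧set⇒bag ux uy (mk⇔ xs⊆ys ys⊆xs)))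

  #distinct-cong : ∀ {xs ys : List B} → xs ⊆ ys → ys ⊆ xs → #distinct xs ≡ #distinct ys
  #distinct-cong {xs} {ys} xs⊆ys ys⊆xs =
    unique-length (deduplicate-! xs) (deduplicate-! ys)
      (λ p → ∈-deduplicate⁺ _≟ᴮ_ (xs⊆ys (∈-deduplicate⁻ _≟ᴮ_ xs p)))
      (λ p → ∈-deduplicate⁺ _≟ᴮ_ (ys⊆xs (∈-deduplicate⁻ _≟ᴮ_ ys p)))

  #distinct-∷ : ∀ {x} {xs : List B} → x ∉ xs → #distinct (x ∷ xs) ≡ suc (#distinct xs)
  #distinct-∷ {x} {xs} x∉xs = cong (λ ys → suc (length ys))
    (filter-all (λ y → ¬? (x ≟ᴮ y)) (All.tabulate λ y∈ x≡y →
      x∉xs (subst (_∈ xs) (sym x≡y) (∈-deduplicate⁻ _≟ᴮ_ xs y∈))))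

  #distinct-pos : ∀ {x} {xs : List B} → x ∈ xs → 1 ≤ #distinct xs
  #distinct-pos {xs = _ ∷ _} _ = s≤s z≤n

  #distinct-constant : ∀ {t} {xs : List B} → t ∈ xs → (∀ {z} → z ∈ xs → z ≡ t) →
                       #distinct xs ≡ 1
  #distinct-constant {t} {xs} t∈xs all≡t =
    #distinct-cong {xs} {t ∷ []} (λ p → here (all≡t p)) (λ { (here refl) → t∈xs })

  #distinct-map : (f : B → B) → Injective _≡_ _≡_ f → ∀ xs → #distinct (map f xs) ≡ #distinct xs
  #distinct-map f f-inj xs =
    trans (unique-length (deduplicate-! (map f xs)) (Unique.map⁺ f-inj (deduplicate-! xs)) to from)
          (length-map f (deduplicate _≟ᴮ_ xs))
    where
    to : deduplicate _≟ᴮ_ (map f xs) ⊆ map f (deduplicate _≟ᴮ_ xs)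
    to p with ∈-map⁻ f (∈-deduplicate⁻ _≟ᴮ_ (map f xs) p)
    ... | y , y∈ , refl = ∈-map⁺ f (∈-deduplicate⁺ _≟ᴮ_ y∈)
    from : map f (deduplicate _≟ᴮ_ xs) ⊆ deduplicate _≟ᴮ_ (map f xs)
    from p with ∈-map⁻ f p
    ... | y , y∈ , refl = ∈-deduplicate⁺ _≟ᴮ_ (∈-map⁺ f (∈-deduplicate⁻ _≟ᴮ_ xs y∈))

take-length-++ : ∀ {A : Set} (xs ys : List A) → take (length xs) (xs ++ ys) ≡ xs
take-length-++ []       ys = refl
take-length-++ (x ∷ xs) ys = cong (x ∷_) (take-length-++ xs ys)

drop-length-++ : ∀ {A : Set} (xs ys : List A) → drop (length xs) (xs ++ ys) ≡ ys
drop-length-++ []       ys = refl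
drop-length-++ (x ∷ xs) ys = drop-length-++ xs ys

length-++₃ : ∀ {A : Set} (xs ys zs : List A) →
             length (xs ++ ys ++ zs) ≡ length xs + (length ys + length zs)
length-++₃ xs ys zs = trans (length-++ xs) (cong (length xs +_) (length-++ ys))

length-take-≤ : ∀ {A : Set} n (xs : List A) → n ≤ length xs → length (take n xs) ≡ n
length-take-≤ n xs n≤ = trans (length-take n xs) (m≤n⇒m⊓n≡m n≤)

equal-entries : ∀ {A : Set} {z z′ : List A} → length z ≡ length z′ →
                (∀ {x y} → x ∈ z → y ∈ z′ → x ≡ y) → z ≡ z′
equal-entries {z = []}    {[]}     _   _     = refl
equal-entries {z = x ∷ z} {y ∷ z′} len agree =
  cong₂ _∷_ (agree (here refl) (here refl))
            (equal-entries (suc-injective len) (λ p q → agree (there p) (there q)))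

++-split : ∀ {A : Set} (r x y s : List A) → r ++ x ≡ y ++ s →
           (∃ λ h → y ≡ r ++ h × x ≡ h ++ s) ⊎ (∃ λ h → r ≡ y ++ h × s ≡ h ++ x)
++-split []      x y       s eq = inj₁ (y , refl , eq)
++-split (a ∷ r) x []      s eq = inj₂ (a ∷ r , refl , sym eq)
++-split (a ∷ r) x (b ∷ y) s eq with ∷-injective eq
... | refl , eq′ with ++-split r x y s eq′
...   | inj₁ (h , y≡ , x≡) = inj₁ (h , cong (a ∷_) y≡ , x≡)
...   | inj₂ (h , r≡ , s≡) = inj₂ (h , cong (a ∷_) r≡ , s≡)

shift⇔ : ∀ {x y x′ y′} k → x ≡ x′ + k → y ≡ y′ + k → (x ≡ y) ⇔ (x′ ≡ y′)
shift⇔ k x≡ y≡ = mk⇔ (λ e → +-cancelʳ-≡ k _ _ (trans (sym x≡) (trans e y≡)))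
                     (λ e → trans x≡ (trans (cong (_+ k) e) (sym y≡)))

unit-descent : ∀ {f : ℕ → ℕ} {L c} → (∀ n → L ≤ n → f n ≡ c ∸ n) →
               ∀ i → L ≤ i → f (suc i) ≡ f i ∸ 1
unit-descent {f} {L} {c} f≡ i L≤i = begin
  f (suc i)    ≡⟨ f≡ (suc i) (≤-trans L≤i (n≤1+n i)) ⟩
  c ∸ suc i    ≡⟨ cong (c ∸_) (+-comm 1 i) ⟩
  c ∸ (i + 1)  ≡⟨ ∸-+-assoc c i 1 ⟨
  c ∸ i ∸ 1    ≡⟨ cong (_∸ 1) (f≡ i L≤i) ⟨
  f i ∸ 1      ∎
  where open ≡-Reasoning

<⇒≤∸1 : ∀ {m n} → m < n → m ≤ n ∸ 1
<⇒≤∸1 (s≤s m≤n) = m≤n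

≤∸1⇒< : ∀ {m n} → 1 ≤ n → m ≤ n ∸ 1 → m < n
≤∸1⇒< {n = suc _} _ m≤ = s≤s m≤

module _ {A : Set} (_≟_ : DecidableEquality A) where
  open Distinct _≟_ using (#distinct; #distinct-∷; #distinct-cong; #distinct-pos)
  private module Factors = Distinct (≡-dec _≟_)

  occ-++ : ∀ a xs ys → occ _≟_ a (xs ++ ys) ≡ occ _≟_ a xs + occ _≟_ a ys
  occ-++ a xs ys = trans (cong length (filter-++ (a ≟_) xs ys)) (length-++ (filter (a ≟_) xs))

  occ-reverse : ∀ a xs → occ _≟_ a (reverse xs) ≡ occ _≟_ a xs
  occ-reverse a xs = ↭-length (filter-↭ (a ≟_) (↭-reverse xs))

  occ-pos : ∀ {a xs} → a ∈ xs → 1 ≤ occ _≟_ a xs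
  occ-pos = filter-some (_ ≟_)

  OnceIn : List A → List A → Set
  OnceIn w r = All (λ a → occ _≟_ a w ≡ 1) r

  once⇒∉ : ∀ {x ys} → occ _≟_ x (x ∷ ys) ≡ 1 → x ∉ ys
  once⇒∉ {x} {ys} once x∈ys = <⇒≱ (occ-pos x∈ys)
    (≤-reflexive (suc-injective (trans (sym (cong length (filter-accept (x ≟_) refl))) once)))

  OnceIn-suffix : ∀ xs {ys r} → r ⊆ ys → OnceIn (xs ++ ys) r → OnceIn ys r
  OnceIn-suffix xs {ys} r⊆ys once = All.tabulate λ {a} a∈r →
    m+n≡1⇒n≡1 (trans (sym (occ-++ a xs ys)) (All.lookup once a∈r)) (occ-pos (r⊆ys a∈r))
    where
    m+n≡1⇒n≡1 : ∀ {m n} → m + n ≡ 1 → 1 ≤ n → n ≡ 1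
    m+n≡1⇒n≡1 {zero}  e _ = e
    m+n≡1⇒n≡1 {suc zero} {suc n} ()
    m+n≡1⇒n≡1 {suc (suc m)} ()

  all-once⇒#distinct : ∀ w → OnceIn w w → #distinct w ≡ length w
  all-once⇒#distinct []      _ = refl
  all-once⇒#distinct (x ∷ w) (x-once ∷ w-once) =
    trans (#distinct-∷ (once⇒∉ x-once))
          (cong suc (all-once⇒#distinct w (OnceIn-suffix (x ∷ []) (λ p → p) w-once)))

  C′ : List A → ℕ → ℕ
  C′ = C _≟_

  Fac : List A → ℕ → List (List A)
  Fac = factorsOfLength _≟_

  IsFactor : List A → ℕ → List A → Set
  IsFactor w n z = length z ≡ n × ∃₂ λ a b → w ≡ a ++ z ++ b

  factor⁻ : ∀ w n {z} → z ∈ Fac w n → IsFactor w n z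
  factor⁻ w n z∈ with n ≤? length w
  ... | no _ = ⊥-elim (Any.¬Any[] z∈)
  ... | yes n≤w with ∈-map⁻ (λ i → take n (drop i w)) z∈
  ... | i , i∈ , refl = length-take-≤ n (drop i w) n≤rest , take i w , drop n (drop i w) , sym split
    where
    n≤rest : n ≤ length (drop i w)
    n≤rest = subst (n ≤_) (sym (length-drop i w))
      (subst (_≤ length w ∸ i) (m∸[m∸n]≡n n≤w) (∸-monoʳ-≤ (length w) (≤-pred (∈-upTo⁻ i∈))))
    split : take i w ++ take n (drop i w) ++ drop n (drop i w) ≡ w
    split = trans (cong (take i w ++_) (take++drop≡id n (drop i w))) (take++drop≡id i w)

  factor-length : ∀ {w n z} → IsFactor w n z → n ≤ length w
  factor-length {z = z} (refl , a , b , refl) =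
    subst (length z ≤_) (sym (length-++₃ a z b)) (≤-trans (m≤m+n _ (length b)) (m≤n+m _ (length a)))

  factor⁺ : ∀ w n {z} → IsFactor w n z → z ∈ Fac w n
  factor⁺ w n fac with n ≤? length w
  ... | no n≰w = ⊥-elim (n≰w (factor-length fac))
  factor⁺ w n {z} (refl , a , b , refl) | yes _ =
    subst (_∈ map (λ i → take n (drop i w)) (upTo (suc (length w ∸ n))))
      (trans (cong (take n) (drop-length-++ a (z ++ b))) (take-length-++ z b))
      (∈-map⁺ (λ i → take n (drop i w)) (∈-upTo⁺ (s≤s a≤)))
    where
    a≤ : length a ≤ length w ∸ n
    a≤ = m+n≤o⇒m≤o∸n (length a)
      (subst (length a + n ≤_) (sym (length-++₃ a _ b)) (+-monoʳ-≤ (length a) (m≤m+n n (length b))))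

  prefix-factor : ∀ w n → n ≤ length w → IsFactor w n (take n w)
  prefix-factor w n n≤w = length-take-≤ n w n≤w , [] , drop n w , sym (take++drop≡id n w)

  full-factor : ∀ {w z} → IsFactor w (length w) z → z ≡ w
  full-factor {z = z} (z-len , a , b , refl) = no-padding a b z-len
    where
    no-padding : ∀ a b → length z ≡ length (a ++ z ++ b) → z ≡ a ++ z ++ b
    no-padding []      []      _     = sym (++-identityʳ z)
    no-padding []      (y ∷ b) z-len =
      ⊥-elim (m+1+n≰m (length z) (≤-reflexive (sym (trans z-len (length-++ z)))))
    no-padding (x ∷ a) b       z-len =
      ⊥-elim (<-irrefl z-len (s≤s (factor-length {a ++ z ++ b} (refl , a , b , refl))))

  C-zero : ∀ w → C′ w 0 ≡ 1
  C-zero w = #distinct-constant (factor⁺ w 0 (refl , [] , w , refl))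
    (λ {z} z∈ → length≡0 z (proj₁ (factor⁻ w 0 z∈)))
    where
    open Factors using (#distinct-constant)
    length≡0 : ∀ (z : List A) → length z ≡ 0 → z ≡ []
    length≡0 [] _ = refl

  C-beyond : ∀ w n → length w < n → C′ w n ≡ 0
  C-beyond w n w<n with n ≤? length w
  ... | yes n≤w = ⊥-elim (<⇒≱ w<n n≤w)
  ... | no  _   = refl

  C-full : ∀ w → C′ w (length w) ≡ 1
  C-full w = #distinct-constant (factor⁺ w (length w) (refl , [] , [] , sym (++-identityʳ w)))
    (λ z∈ → full-factor (factor⁻ w (length w) z∈))
    where open Factors using (#distinct-constant)

  C-pos : ∀ w n → n ≤ length w → 1 ≤ C′ w n
  C-pos w n n≤w = Factors.#distinct-pos (factor⁺ w n (prefix-factor w n n≤w))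

  C-tail : ∀ w n → length w ≤ n → C′ w n ≡ suc (length w) ∸ n
  C-tail w n w≤n with m≤n⇒m<n∨m≡n w≤n
  ... | inj₁ w<n  = trans (C-beyond w n w<n) (sym (m≤n⇒m∸n≡0 w<n))
  ... | inj₂ refl = trans (C-full w) (sym (m+n∸n≡m 1 (length w)))

  -- Prepending a letter x not occurring in u adds exactly one factor of each
  -- length 1 ≤ n ≤ |u| + 1, namely the prefix of x ∷ u of length n.
  C-∷-fresh : ∀ {x u} n → x ∉ u → 1 ≤ n → n ≤ suc (length u) → C′ (x ∷ u) n ≡ suc (C′ u n)
  C-∷-fresh {x} {u} n@(suc _) x∉u _ n≤ =
    trans (Factors.#distinct-cong to from) (Factors.#distinct-∷ prefix∉)
    where
    prefix : List A
    prefix = take n (x ∷ u)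
    prefix∉ : prefix ∉ Fac u n
    prefix∉ p with factor⁻ u n p
    ... | _ , a , b , u≡ = x∉u (subst (x ∈_) (sym u≡) (∈-++⁺ʳ a (here refl)))
    to : Fac (x ∷ u) n ⊆ prefix ∷ Fac u n
    to p with factor⁻ (x ∷ u) n p
    ... | z-len , []    , b , xu≡ = here (trans (sym (take-length-++ _ b))
                                         (cong₂ take z-len (sym xu≡)))
    ... | z-len , _ ∷ a , b , xu≡ = there (factor⁺ u n (z-len , a , b , proj₂ (∷-injective xu≡)))
    from : prefix ∷ Fac u n ⊆ Fac (x ∷ u) n
    from (here refl) = factor⁺ (x ∷ u) n (prefix-factor (x ∷ u) n n≤)
    from (there p) with factor⁻ u n p
    ... | z-len , a , b , u≡ = factor⁺ (x ∷ u) n (z-len , x ∷ a , b , cong (x ∷_) u≡)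

  -- Reversal maps factors to factors, so the complexity is reversal-invariant.
  C-reverse : ∀ w n → C′ (reverse w) n ≡ C′ w n
  C-reverse w n =
    trans (Factors.#distinct-cong to from) (Factors.#distinct-map reverse reverse-injective (Fac w n))
    where
    reverse-factor : ∀ {v n y} → IsFactor v n y → IsFactor (reverse v) n (reverse y)
    reverse-factor {y = y} (y-len , a , b , refl) =
      trans (length-reverse y) y-len , reverse b , reverse a ,
      trans (reverse-++ a (y ++ b))
        (trans (cong (_++ reverse a) (reverse-++ y b)) (++-assoc (reverse b) (reverse y) (reverse a)))
    to : Fac (reverse w) n ⊆ map reverse (Fac w n)
    to {z} p = subst (_∈ map reverse (Fac w n)) (reverse-involutive z)
      (∈-map⁺ reverse (factor⁺ w n (subst (λ v → IsFactor v n (reverse z)) (reverse-involutive w)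
        (reverse-factor (factor⁻ (reverse w) n p)))))
    from : map reverse (Fac w n) ⊆ Fac (reverse w) n
    from p with ∈-map⁻ reverse p
    ... | y , y∈ , refl = factor⁺ (reverse w) n (reverse-factor (factor⁻ w n y∈))

  #distinct-reverse : ∀ w → #distinct (reverse w) ≡ #distinct w
  #distinct-reverse w = #distinct-cong {reverse w} {w} Any.reverse⁻ Any.reverse⁺

  -- Extension w v: w arises from v by adding `extra` letters that occur only once
  -- in w.
  record Extension (w v : List A) : Set where
    field
      extra      : ℕ
      v-nonempty : 1 ≤ length v
      length≡    : length w ≡ length v + extra
      letters≡   : #distinct w ≡ #distinct v + extra
      C-shift    : ∀ n → 1 ≤ n → n ≤ suc (length v) → C′ w n ≡ C′ v n + extra
      C-long     : ∀ n → length v ≤ n → C′ w n ≡ suc (length w) ∸ n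

  Extension-refl : ∀ v → 1 ≤ length v → Extension v v
  Extension-refl v v-nonempty = record
    { extra      = 0
    ; v-nonempty = v-nonempty
    ; length≡    = sym (+-identityʳ _)
    ; letters≡   = sym (+-identityʳ _)
    ; C-shift    = λ _ _ _ → sym (+-identityʳ _)
    ; C-long     = C-tail v
    }

  Extension-trans : ∀ {w u v} → Extension w u → Extension u v → Extension w v
  Extension-trans {w} {u} {v} w/u u/v = record
    { extra      = k₂ + k₁
    ; v-nonempty = u/v.v-nonempty
    ; length≡    = trans w/u.length≡ (trans (cong (_+ k₁) u/v.length≡) (+-assoc _ k₂ k₁))
    ; letters≡   = trans w/u.letters≡ (trans (cong (_+ k₁) u/v.letters≡) (+-assoc _ k₂ k₁))
    ; C-shift    = λ n 1≤n n≤ → trans (w/u.C-shift n 1≤n (≤-trans n≤ (s≤s v≤u)))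
                                      (trans (cong (_+ k₁) (u/v.C-shift n 1≤n n≤)) (+-assoc _ k₂ k₁))
    ; C-long     = C-long
    }
    where
    module w/u = Extension w/u
    module u/v = Extension u/v
    k₁ k₂ : ℕ
    k₁ = w/u.extra
    k₂ = u/v.extra
    v≤u : length v ≤ length u
    v≤u = subst (length v ≤_) (sym u/v.length≡) (m≤m+n _ k₂)
    C-long : ∀ n → length v ≤ n → C′ w n ≡ suc (length w) ∸ n
    C-long n v≤n with length u ≤? n
    ... | yes u≤n = w/u.C-long n u≤n
    ... | no  u≰n = begin
      C′ w n                     ≡⟨ w/u.C-shift n (≤-trans u/v.v-nonempty v≤n) n≤1+u ⟩
      C′ u n + k₁                ≡⟨ cong (_+ k₁) (u/v.C-long n v≤n) ⟩
      (suc (length u) ∸ n) + k₁  ≡⟨ +-∸-comm k₁ n≤1+u ⟨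
      suc (length u) + k₁ ∸ n    ≡⟨ cong (λ l → suc l ∸ n) w/u.length≡ ⟨
      suc (length w) ∸ n         ∎
      where
      open ≡-Reasoning
      n≤1+u : n ≤ suc (length u)
      n≤1+u = m<n⇒m≤1+n (≰⇒> u≰n)

  Extension-∷ : ∀ {x u} → x ∉ u → 1 ≤ length u → Extension (x ∷ u) u
  Extension-∷ {x} {u} x∉u u-nonempty = record
    { extra      = 1
    ; v-nonempty = u-nonempty
    ; length≡    = +-comm 1 (length u)
    ; letters≡   = trans (#distinct-∷ x∉u) (+-comm 1 _)
    ; C-shift    = λ n 1≤n n≤ → trans (C-∷-fresh n x∉u 1≤n n≤) (+-comm 1 _)
    ; C-long     = C-long
    }
    where
    C-long : ∀ n → length u ≤ n → C′ (x ∷ u) n ≡ suc (suc (length u)) ∸ n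
    C-long n u≤n with ≤-total n (suc (length u))
    ... | inj₁ n≤   = trans (C-∷-fresh n x∉u (≤-trans u-nonempty u≤n) n≤)
                            (trans (cong suc (C-tail u n u≤n)) (sym (+-∸-assoc 1 n≤)))
    ... | inj₂ xu≤n = C-tail (x ∷ u) n xu≤n

  Extension-reverse : ∀ {w v} → Extension w v → Extension (reverse w) (reverse v)
  Extension-reverse {w} {v} w/v = record
    { extra      = extra
    ; v-nonempty = subst (1 ≤_) (sym (length-reverse v)) v-nonempty
    ; length≡    = trans (length-reverse w) (trans length≡ (cong (_+ extra) (sym (length-reverse v))))
    ; letters≡   = trans (#distinct-reverse w)
                     (trans letters≡ (cong (_+ extra) (sym (#distinct-reverse v))))
    ; C-shift    = λ n 1≤n n≤ → trans (C-reverse w n)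
                     (trans (C-shift n 1≤n (subst (λ l → n ≤ suc l) (length-reverse v) n≤))
                            (cong (_+ extra) (sym (C-reverse v n))))
    ; C-long     = λ n v≤n → trans (C-reverse w n)
                     (trans (C-long n (subst (_≤ n) (length-reverse v) v≤n))
                            (cong (λ l → suc l ∸ n) (sym (length-reverse w))))
    }
    where open Extension w/v

  Extension-prefix : ∀ r {u} → 1 ≤ length u → OnceIn (r ++ u) r → Extension (r ++ u) u
  Extension-prefix []      {u} u-nonempty _ = Extension-refl u u-nonempty
  Extension-prefix (x ∷ r) {u} u-nonempty (x-once ∷ r-once) =
    Extension-trans (Extension-∷ (once⇒∉ x-once) (≤-trans u-nonempty (length-++-≤ʳ u {r})))
                    (Extension-prefix r u-nonempty (OnceIn-suffix (x ∷ []) (∈-++⁺ˡ) r-once))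

  Extension-suffix : ∀ {u} s → 1 ≤ length u → OnceIn (u ++ s) s → Extension (u ++ s) u
  Extension-suffix {u} s u-nonempty s-once =
    subst₂ Extension reverse-back (reverse-involutive u)
      (Extension-reverse (Extension-prefix (reverse s)
        (subst (1 ≤_) (sym (length-reverse u)) u-nonempty) reversed-once))
    where
    reverse-back : reverse (reverse s ++ reverse u) ≡ u ++ s
    reverse-back = trans (reverse-++ (reverse s) (reverse u))
                         (cong₂ _++_ (reverse-involutive u) (reverse-involutive s))
    reversed-once : OnceIn (reverse s ++ reverse u) (reverse s)
    reversed-once = All.tabulate λ {a} a∈ →
      trans (cong (occ _≟_ a) (sym (reverse-++ u s)))
            (trans (occ-reverse a (u ++ s)) (All.lookup s-once (Any.reverse⁻ a∈)))

  Extension-around : ∀ {w} r v s → w ≡ r ++ v ++ s → 1 ≤ length v →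
                     OnceIn w r → OnceIn w s → Extension w v
  Extension-around r v s refl v-nonempty r-once s-once =
    Extension-trans (Extension-prefix r (≤-trans v-nonempty (length-++-≤ˡ v)) r-once)
                    (Extension-suffix s v-nonempty (OnceIn-suffix r (∈-++⁺ʳ v) s-once))

  record SameShape (L : ℕ) (w₁ w₂ : List A) : Set where
    field
      long₁    : L ≤ length w₁
      long₂    : L ≤ length w₂
      rise⇔    : ∀ i → 1 ≤ i → i ≤ L →
                 (C′ w₁ i ≡ #distinct w₁ + i ∸ 1) ⇔ (C′ w₂ i ≡ #distinct w₂ + i ∸ 1)
      plateau⇔ : ∀ i → 1 ≤ i → i ≤ L → (C′ w₁ (suc i) ≡ C′ w₁ i) ⇔ (C′ w₂ (suc i) ≡ C′ w₂ i)
      descent⇔ : ∀ i → 1 ≤ i → i < L →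
                 (C′ w₁ (suc i) ≡ C′ w₁ i ∸ 1) ⇔ (C′ w₂ (suc i) ≡ C′ w₂ i ∸ 1)
      descent₁ : ∀ i → L ≤ i → C′ w₁ (suc i) ≡ C′ w₁ i ∸ 1
      descent₂ : ∀ i → L ≤ i → C′ w₂ (suc i) ≡ C′ w₂ i ∸ 1

  -- The relation is symmetric, so transfer needs to be shown in one direction only.
  SameShape-sym : ∀ {L w₁ w₂} → SameShape L w₁ w₂ → SameShape L w₂ w₁
  SameShape-sym same = record
    { long₁    = long₂
    ; long₂    = long₁
    ; rise⇔    = λ i 1≤i i≤L → ⇔-sym (rise⇔ i 1≤i i≤L)
    ; plateau⇔ = λ i 1≤i i≤L → ⇔-sym (plateau⇔ i 1≤i i≤L)
    ; descent⇔ = λ i 1≤i i<L → ⇔-sym (descent⇔ i 1≤i i<L)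
    ; descent₁ = descent₂
    ; descent₂ = descent₁
    }
    where open SameShape same

  shape-transfer : ∀ {L w₁ w₂ m M} → SameShape L w₁ w₂ → M ≤ L →
                   GTParams _≟_ w₁ m M → GTParams _≟_ w₂ m M
  shape-transfer {L} {w₁} {w₂} {m} {M} same M≤L (1≤m , m≤M , _ , rise , plateau , descent) =
    1≤m , m≤M , C-zero w₂ , rise′ , plateau′ , descent′
    where
    open SameShape same
    open Equivalence using (to)
    rise′ : ∀ i → 1 ≤ i → i ≤ m → C′ w₂ i ≡ #distinct w₂ + i ∸ 1
    rise′ i 1≤i i≤m = to (rise⇔ i 1≤i (≤-trans i≤m (≤-trans m≤M M≤L))) (rise i 1≤i i≤m)
    plateau′ : ∀ i → m ≤ i → i ≤ M ∸ 1 → C′ w₂ (suc i) ≡ C′ w₂ i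
    plateau′ i m≤i i≤ = to (plateau⇔ i (≤-trans 1≤m m≤i) (≤-trans i≤ (≤-trans (m∸n≤m M 1) M≤L)))
                           (plateau i m≤i i≤)
    descent′ : ∀ i → M ≤ i → i ≤ length w₂ → C′ w₂ (suc i) ≡ C′ w₂ i ∸ 1
    descent′ i M≤i _ with i <? L
    ... | yes i<L = to (descent⇔ i (≤-trans 1≤m (≤-trans m≤M M≤i)) i<L)
                       (descent i M≤i (≤-trans (<⇒≤ i<L) long₁))
    ... | no  i≮L = descent₂ i (≮⇒≥ i≮L)

  extension-shape : ∀ {w v} → Extension w v → SameShape (length v) w v
  extension-shape {w} {v} w/v = record
    { long₁    = subst (length v ≤_) (sym length≡) (m≤m+n _ extra)
    ; long₂    = ≤-refl
    ; rise⇔    = λ i 1≤i i≤L → shift⇔ extra (C-shift i 1≤i (m≤n⇒m≤1+n i≤L)) (letters-shift i 1≤i)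
    ; plateau⇔ = λ i 1≤i i≤L → shift⇔ extra (C-shift (suc i) (s≤s z≤n) (s≤s i≤L))
                                              (C-shift i 1≤i (m≤n⇒m≤1+n i≤L))
    ; descent⇔ = λ i 1≤i i<L → shift⇔ extra (C-shift (suc i) (s≤s z≤n) (m≤n⇒m≤1+n i<L))
                   (trans (cong (_∸ 1) (C-shift i 1≤i (m<n⇒m≤1+n i<L)))
                          (+-∸-comm extra (C-pos v i (<⇒≤ i<L))))
    ; descent₁ = unit-descent C-long
    ; descent₂ = unit-descent (C-tail v)
    }
    where
    open Extension w/v
    letters-shift : ∀ i → 1 ≤ i → #distinct w + i ∸ 1 ≡ (#distinct v + i ∸ 1) + extra
    letters-shift i 1≤i = begin
      #distinct w + i ∸ 1               ≡⟨ +-∸-assoc (#distinct w) 1≤i ⟩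
      #distinct w + (i ∸ 1)             ≡⟨ cong (_+ (i ∸ 1)) letters≡ ⟩
      #distinct v + extra + (i ∸ 1)     ≡⟨ xy∙z≈xz∙y (#distinct v) extra (i ∸ 1) ⟩
      #distinct v + (i ∸ 1) + extra     ≡⟨ cong (_+ extra) (+-∸-assoc (#distinct v) 1≤i) ⟨
      (#distinct v + i ∸ 1) + extra     ∎
      where open ≡-Reasoning

  C-at-core : ∀ {w v} (w/v : Extension w v) → C′ w (length v) ≡ suc (Extension.extra w/v)
  C-at-core {w} {v} w/v = begin
    C′ w L                 ≡⟨ C-long L ≤-refl ⟩
    suc (length w) ∸ L     ≡⟨ cong (λ l → suc l ∸ L) length≡ ⟩
    suc (L + extra) ∸ L    ≡⟨ cong (_∸ L) (+-suc L extra) ⟨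
    L + suc extra ∸ L      ≡⟨ m+n∸m≡n L (suc extra) ⟩
    suc extra              ∎
    where
    open Extension w/v
    open ≡-Reasoning
    L = length v

  C-after-core : ∀ {w v} (w/v : Extension w v) → C′ w (suc (length v)) ≡ Extension.extra w/v
  C-after-core {w} {v} w/v =
    trans (C-long (suc L) (n≤1+n L)) (trans (cong (_∸ L) length≡) (m+n∸m≡n L extra))
    where
    open Extension w/v
    L = length v

  -- Under an extension the descent starts at most at |v|: from |v| to |v|+1 the
  -- complexity of w drops from extra + 1 to extra, which is neither a plateau
  -- nor part of the rising phase (there C_w(|v|+1) ≥ extra + |v| > extra).
  params-bound : ∀ {w v m M} → Extension w v → GTParams _≟_ w m M → M ≤ length v
  params-bound {w} {v} {m} {M} w/v (_ , _ , _ , rise , plateau , _) with M ≤? length v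
  ... | yes M≤v = M≤v
  ... | no  M≰v with m ≤? length v
  ...   | yes m≤v = ⊥-elim (1+n≢n (begin
    suc extra     ≡⟨ C-at-core w/v ⟨
    C′ w L        ≡⟨ plateau L m≤v (<⇒≤∸1 (≰⇒> M≰v)) ⟨
    C′ w (suc L)  ≡⟨ C-after-core w/v ⟩
    extra         ∎))
    where
    open Extension w/v
    open ≡-Reasoning
    L = length v
  ...   | no  m≰v = ⊥-elim (<-irrefl extra≡ extra<)
    where
    open Extension w/v
    L = length v
    extra≡ : extra ≡ #distinct w + L
    extra≡ = trans (sym (C-after-core w/v))
                   (trans (rise (suc L) (s≤s z≤n) (≰⇒> m≰v)) (cong (_∸ 1) (+-suc (#distinct w) L)))
    extra< : extra < #distinct w + L
    extra< = <-≤-trans (m<m+n extra v-nonempty)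
                       (+-monoˡ-≤ L (subst (extra ≤_) (sym letters≡) (m≤n+m extra _)))

  params⇔ : ∀ {w v m M} → Extension w v → GTParams _≟_ w m M ⇔ GTParams _≟_ v m M
  params⇔ {v = v} w/v = mk⇔
    (λ P → shape-transfer same (params-bound w/v P) P)
    (λ P → shape-transfer (SameShape-sym same)
             (params-bound (Extension-refl v (Extension.v-nonempty w/v)) P) P)
    where same = extension-shape w/v

  factor-⊆ : ∀ {w n z} → IsFactor w n z → z ⊆ w
  factor-⊆ (_ , a , b , refl) p = ∈-++⁺ʳ a (∈-++⁺ˡ p)

  C-unary : ∀ u → #distinct u ≡ 1 → ∀ n → n ≤ length u → C′ u n ≡ 1
  C-unary u one n n≤u = Factors.#distinct-constant (factor⁺ u n (prefix-factor u n n≤u))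
    (λ z∈ → equal-entries (trans (proj₁ (factor⁻ u n z∈)) (sym (length-take-≤ n u n≤u)))
              (λ x∈ y∈ → same (factor-⊆ (factor⁻ u n z∈) x∈)
                              (factor-⊆ (prefix-factor u n n≤u) y∈)))
    where
    single : ∀ {xs : List A} {x y} → length xs ≡ 1 → x ∈ xs → y ∈ xs → x ≡ y
    single {_ ∷ []} _ (here refl) (here refl) = refl
    same : ∀ {x y} → x ∈ u → y ∈ u → x ≡ y
    same x∈ y∈ = single one (∈-deduplicate⁺ _≟_ x∈) (∈-deduplicate⁺ _≟_ y∈)

  unary-params : ∀ u → 1 ≤ length u → #distinct u ≡ 1 → GTParams _≟_ u 1 (length u)
  unary-params u u-nonempty one =
    ≤-refl , u-nonempty , C-zero u , rise , plateau , λ i u≤i _ → unit-descent (C-tail u) i u≤i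
    where
    rise : ∀ i → 1 ≤ i → i ≤ 1 → C′ u i ≡ #distinct u + i ∸ 1
    rise 1 _ _ = trans (C-unary u one 1 u-nonempty) (sym (trans (m+n∸n≡m (#distinct u) 1) one))
    rise (suc (suc _)) _ (s≤s ())
    plateau : ∀ i → 1 ≤ i → i ≤ length u ∸ 1 → C′ u (suc i) ≡ C′ u i
    plateau i _ i≤ = trans (C-unary u one (suc i) i<u) (sym (C-unary u one i (<⇒≤ i<u)))
      where
      i<u : i < length u
      i<u = ≤∸1⇒< u-nonempty i≤

  HasParams : List A → Set
  HasParams u = ∃₂ λ m M → GTParams _≟_ u m M

  nonempty⇒≢[] : ∀ {u : List A} → 1 ≤ length u → u ≢ []
  nonempty⇒≢[] {_ ∷ _} _ ()

  GTWord⇒params : ∀ u → GTWord _≟_ u → HasParams u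
  GTWord⇒params u       (inj₁ (_ , params))  = params
  GTWord⇒params []      (inj₂ (u≢[] , _))    = ⊥-elim (u≢[] refl)
  GTWord⇒params (x ∷ u) (inj₂ (_ , one))     = 1 , suc (length u) , unary-params (x ∷ u) (s≤s z≤n) one

  params⇒GTWord : ∀ u → u ≢ [] → HasParams u → GTWord _≟_ u
  params⇒GTWord []      u≢[] _ = ⊥-elim (u≢[] refl)
  params⇒GTWord (x ∷ u) u≢[] params with 2 ≤? #distinct (x ∷ u)
  ... | yes 2≤ = inj₁ (2≤ , params)
  ... | no  2≰ = inj₂ (u≢[] , ≤-antisym (≤-pred (≰⇒> 2≰)) (#distinct-pos {xs = x ∷ u} (here refl)))

  map-params : ∀ {u u′} → (∀ {m M} → GTParams _≟_ u m M → GTParams _≟_ u′ m M) →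
               HasParams u → HasParams u′
  map-params f (m , M , params) = m , M , f params

  GTWord⇔ : ∀ {w v} → Extension w v → w ≢ [] → GTWord _≟_ w ⇔ GTWord _≟_ v
  GTWord⇔ {w} {v} w/v w≢[] = mk⇔
    (λ gt → params⇒GTWord v (nonempty⇒≢[] (Extension.v-nonempty w/v))
              (map-params (Equivalence.to (params⇔ w/v)) (GTWord⇒params w gt)))
    (λ gt → params⇒GTWord w w≢[] (map-params (Equivalence.from (params⇔ w/v)) (GTWord⇒params v gt)))

  MaxInterval⇔ : ∀ {w v m M} → Extension w v → MaxInterval _≟_ w m M ⇔ MaxInterval _≟_ v m M
  MaxInterval⇔ w/v = mk⇔
    (λ (params , maximal) → to params , λ m′ M′ params′ → maximal m′ M′ (from params′))
    (λ (params , maximal) → from params , λ m′ M′ params′ → maximal m′ M′ (to params′))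
    where
    to : ∀ {m M} → GTParams _≟_ _ m M → GTParams _≟_ _ m M
    to = Equivalence.to (params⇔ w/v)
    from : ∀ {m M} → GTParams _≟_ _ m M → GTParams _≟_ _ m M
    from = Equivalence.from (params⇔ w/v)

  once? : (w : List A) → Decidable (λ a → occ _≟_ a w ≡ 1)
  once? w a = occ _≟_ a w ≟ℕ 1

  heartPrefix-once : ∀ w → OnceIn w (heartPrefix _≟_ w)
  heartPrefix-once w = All.all-takeWhile (once? w) w

  heartSuffix-once : ∀ w → OnceIn w (heartSuffix _≟_ w)
  heartSuffix-once w = All.tabulate λ a∈ →
    All.lookup (All.all-takeWhile (once? w) (reverse w)) (Any.reverse⁻ a∈)

  beforeSuffix : List A → List A
  beforeSuffix w = reverse (dropWhile (once? w) (reverse w))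

  beforeSuffix-++ : ∀ w → beforeSuffix w ++ heartSuffix _≟_ w ≡ w
  beforeSuffix-++ w = begin
    beforeSuffix w ++ heartSuffix _≟_ w  ≡⟨ reverse-++ (takeWhile (once? w) (reverse w)) _ ⟨
    reverse (takeWhile (once? w) (reverse w) ++ dropWhile (once? w) (reverse w))
                                         ≡⟨ cong reverse (takeWhile++dropWhile (once? w) (reverse w)) ⟩
    reverse (reverse w)                  ≡⟨ reverse-involutive w ⟩
    w                                    ∎
    where open ≡-Reasoning

  repeat-before-suffix : ∀ w → #distinct w < length w → ¬ OnceIn w (beforeSuffix w)
  repeat-before-suffix w repeats before-once = <⇒≢ repeats (all-once⇒#distinct w
    (subst (OnceIn w) (beforeSuffix-++ w) (All.++⁺ before-once (heartSuffix-once w))))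

  -- If some letter of w repeats, then w = r h s with r = heartPrefix w,
  -- s = heartSuffix w and h non-empty: comparing w = r · rest with
  -- w = beforeSuffix · s, the heart prefix cannot reach into or past beforeSuffix.
  heart-split : ∀ w → #distinct w < length w →
                ∃ λ h → w ≡ heartPrefix _≟_ w ++ h ++ heartSuffix _≟_ w × 1 ≤ length h
  heart-split w repeats
    with ++-split (heartPrefix _≟_ w) (dropWhile (once? w) w) (beforeSuffix w) (heartSuffix _≟_ w)
                  (trans (takeWhile++dropWhile (once? w) w) (sym (beforeSuffix-++ w)))
  ... | inj₁ (x ∷ h , _ , rest≡) =
    x ∷ h ,
    trans (sym (takeWhile++dropWhile (once? w) w)) (cong (heartPrefix _≟_ w ++_) rest≡) ,
    s≤s z≤n
  ... | inj₁ ([] , before≡ , _) = ⊥-elim (repeat-before-suffix w repeats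
    (subst (OnceIn w) (sym (trans before≡ (++-identityʳ _))) (heartPrefix-once w)))
  ... | inj₂ (h , prefix≡ , _) = ⊥-elim (repeat-before-suffix w repeats
    (All.++⁻ˡ (beforeSuffix w) (subst (OnceIn w) prefix≡ (heartPrefix-once w))))

  middle : ∀ {w} (r h s : List A) → w ≡ r ++ h ++ s →
           take (length w ∸ length r ∸ length s) (drop (length r) w) ≡ h
  middle r h s refl = trans (cong₂ take middle-length (drop-length-++ r (h ++ s))) (take-length-++ h s)
    where
    middle-length : length (r ++ h ++ s) ∸ length r ∸ length s ≡ length h
    middle-length = trans (cong (λ l → l ∸ length r ∸ length s) (length-++₃ r h s))
      (trans (cong (_∸ length s) (m+n∸m≡n (length r) (length h + length s)))
             (m+n∸n≡m (length h) (length s)))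

  heart-cases : ∀ w → heart _≟_ w ≡ w ⊎ Extension w (heart _≟_ w)
  heart-cases w with length (Alph _≟_ w) <? length w
  ... | no  _       = inj₁ refl
  ... | yes repeats with heart-split w repeats
  ...   | h , w≡rhs , h-nonempty =
    inj₂ (subst (Extension w) (sym (middle (heartPrefix _≟_ w) h (heartSuffix _≟_ w) w≡rhs))
      (Extension-around _ h _ w≡rhs h-nonempty (heartPrefix-once w) (heartSuffix-once w)))

lemma3p3 : {A : Set} (_≟_ : DecidableEquality A) (w : List A) → w ≢ [] →
    (GTWord _≟_ w ⇔ GTWord _≟_ (heart _≟_ w)) ×
    (GTWord _≟_ w → ∀ (m M : ℕ) →
      (MaxInterval _≟_ w m M ⇔ MaxInterval _≟_ (heart _≟_ w) m M))
lemma3p3 _≟_ w w≢[] with heart-cases _≟_ w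
... | inj₁ heart≡w rewrite heart≡w = ⇔-refl , λ _ _ _ → ⇔-refl
... | inj₂ w/heart = GTWord⇔ _≟_ w/heart w≢[] , λ _ _ _ → MaxInterval⇔ _≟_ w/heart
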